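{- Let $A=(a_0,\dots,a_{n-1})$ be an array of pairwise distinct numbers and $k>1$ an integer, and run the following greedy algorithm: set $i=0$; repeat: find the smallest $j\ge i$ such that $(a_i,\dots,a_j)$ contains an increasing subsequence of length $k$ (stop if none exists); find the largest $q\le j$ such that $(a_q,\dots,a_j)$ contains an increasing subsequence of length $k$; output the suffix $(q,j)$; set $i=q+1$. Consider any two consecutive steps of this algorithm. In the first, let $S=(b,c)$ be the computed suffix and let $X=(x_1,\dots,x_k)$ be the lexicographically minimal (with respect to the sequence of positions) increasing subsequence of length $k$ in $(a_b,\dots,a_c)$, where $x_t$ denotes the position of its $t$-th element. In the second step, let $X'=(x'_1,\dots,x'_k)$ be the lexicographically minimal increasing subsequence of length $k$ in the suffix computed in that step. Then $x'_i\ge x_{i+1}$ for all $1\le i<k$.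
   Context: An increasing subsequence of length $k$ in a subarray $(a_q,\dots,a_j)$ is identified with its sequence of positions $q\le p_1<\dots<p_k\le j$ with $a_{p_1}<\dots<a_{p_k}$; lexicographic minimality refers to comparing these position sequences lexicographically. -}

module Defs where

open import Level using (Level; _⊔_)
open import Data.Nat using (ℕ; zero; suc; _≤_; _<_)
open import Data.Fin using (Fin; toℕ)
open import Data.Product using (Σ; ∃; _×_; _,_)
open import Data.Sum using (_⊎_)
open import Relation.Nullary using (¬_)
open import Relation.Binary.PropositionalEquality using (_≡_)
open import Relation.Binary.Bundles using (StrictTotalOrder)

module Greedy {c ℓ₁ ℓ₂ : Level} (O : StrictTotalOrder c ℓ₁ ℓ₂)
              (n : ℕ) (a : Fin n → StrictTotalOrder.Carrier O) (k : ℕ) where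
  open StrictTotalOrder O renaming (_<_ to _≺_)

  -- A sequence of positions (p_0 < … < p_{k-1}) (0-indexed here) forming an
  -- increasing subsequence of length k of the subarray (a_q, …, a_j).
  IsIncSubseq : ℕ → ℕ → (Fin k → Fin n) → Set ℓ₂
  IsIncSubseq q j p =
    (∀ s t → toℕ s < toℕ t → (toℕ (p s) < toℕ (p t)) × (a (p s) ≺ a (p t)))
    × (∀ t → (q ≤ toℕ (p t)) × (toℕ (p t) ≤ j))

  HasIncSubseq : ℕ → ℕ → Set ℓ₂
  HasIncSubseq q j = Σ (Fin k → Fin n) (IsIncSubseq q j)

  _≤lex_ : (Fin k → Fin n) → (Fin k → Fin n) → Set
  p ≤lex r = (∀ t → p t ≡ r t)
           ⊎ Σ (Fin k) (λ t → (∀ s → toℕ s < toℕ t → p s ≡ r s) × (toℕ (p t) < toℕ (r t)))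

  IsLexMinIncSubseq : ℕ → ℕ → (Fin k → Fin n) → Set ℓ₂
  IsLexMinIncSubseq q j p =
    IsIncSubseq q j p × (∀ r → IsIncSubseq q j r → p ≤lex r)

  Step : ℕ → ℕ → ℕ → Set ℓ₂
  Step i q j =
    (i ≤ j) × (j < n) × HasIncSubseq i j
    × (∀ j' → i ≤ j' → j' < j → ¬ HasIncSubseq i j')
    × (q ≤ j) × HasIncSubseq q j
    × (∀ q' → q < q' → q' ≤ j → ¬ HasIncSubseq q' j)

  data Reached : ℕ → Set (c ⊔ ℓ₁ ⊔ ℓ₂) where
    start : Reached 0
    next  : ∀ {i q j} → Reached i → Step i q j → Reached (suc q)

-- Let x and y be the position sequences of X and of X'. No y_s is ⊏-comparable with
-- x_{s+1} (earlier position and smaller value, in either order): y₀ … y_s x_{s+1} … x_{k-1}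
-- would contradict the maximality of b, and x₁ … x_{s+1} y_s … y_{k-2} the minimality of
-- the end of the second suffix. So if y_t lay strictly before x_{t+1}, the two would cross:
-- a(y_t) > a(x_{t+1}). Following the crossings y_m, x_{m+1} for m = t, t+1, … one reaches an
-- m where x₀ … x_t y_t … y_m x_{m+2} … x_{k-1} is an increasing subsequence of
-- (a_b, …, a_c) lexicographically smaller than X. Induction on t supplies x_t < y_t.
module Submission where

open import Defs
open import Level using (Level)
open import Function using (_∘_)
open import Data.Nat using (ℕ; zero; suc; pred; _+_; _∸_; _≤_; _<_; z≤n; s≤s; z<s; s≤s⁻¹; _≤?_; _<?_)
open import Data.Nat.Properties
open import Data.Fin as Fin using (Fin; toℕ; fromℕ<)
open import Data.Fin.Properties using (toℕ-fromℕ<; fromℕ<-toℕ; toℕ<n; toℕ-injective)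
open import Data.Product using (_×_; _,_; proj₁; proj₂)
open import Data.Sum using (inj₁; inj₂; _⊎_)
open import Data.Empty using (⊥; ⊥-elim)
open import Relation.Nullary using (¬_; yes; no; contradiction)
open import Relation.Binary.Core using (Rel)
open import Relation.Binary.Definitions using (Transitive; tri<; tri≈; tri>)
open import Relation.Binary.PropositionalEquality using (_≡_; refl; sym; trans; cong; subst; subst₂)
open import Relation.Binary.Bundles using (StrictTotalOrder)

downwardInduction : ∀ {p} (P : ℕ → Set p) (hi : ℕ) → P hi
                  → (∀ m → m < hi → P (suc m) → P m) → ∀ m → m ≤ hi → P m
downwardInduction P hi P-hi step m m≤hi = go (hi ∸ m) m (m+[n∸m]≡n m≤hi)
  where
  go : ∀ d m → m + d ≡ hi → P m
  go zero    m m+0≡hi = subst P (trans (sym m+0≡hi) (+-identityʳ m)) P-hi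
  go (suc d) m m+d≡hi = step m (subst (m <_) m+d≡hi (m<m+n m z<s))
                             (go d (suc m) (trans (sym (+-suc m d)) m+d≡hi))

splice : ∀ {a} {A : Set a} → ℕ → (ℕ → A) → (ℕ → A) → ℕ → A
splice s f g i with i ≤? s
... | yes _ = f i
... | no  _ = g i

module _ {a} {A : Set a} {s : ℕ} {f g : ℕ → A} where

  splice-≤ : ∀ {i} → i ≤ s → splice s f g i ≡ f i
  splice-≤ {i} i≤s with i ≤? s
  ... | yes _   = refl
  ... | no  i≰s = contradiction i≤s i≰s

  splice-> : ∀ {i} → s < i → splice s f g i ≡ g i
  splice-> {i} s<i with i ≤? s
  ... | yes i≤s = contradiction i≤s (<⇒≱ s<i)
  ... | no  _   = refl

module Chains {a ℓ} {A : Set a} (_⊏_ : Rel A ℓ) where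

  ChainOn : ℕ → ℕ → (ℕ → A) → Set ℓ
  ChainOn lo hi f = ∀ i → lo ≤ i → i < hi → f i ⊏ f (suc i)

  chainOn-mono : ∀ {lo hi lo′ hi′ f} → lo ≤ lo′ → hi′ ≤ hi → ChainOn lo hi f → ChainOn lo′ hi′ f
  chainOn-mono lo≤lo′ hi′≤hi chain i lo′≤i i<hi′ = chain i (≤-trans lo≤lo′ lo′≤i) (<-≤-trans i<hi′ hi′≤hi)

  chainOn-∘suc : ∀ {lo hi f} → ChainOn (suc lo) (suc hi) f → ChainOn lo hi (f ∘ suc)
  chainOn-∘suc chain i lo≤i i<hi = chain (suc i) (s≤s lo≤i) (s≤s i<hi)

  chainOn-∘pred : ∀ {lo hi f} → ChainOn lo hi f → ChainOn (suc lo) (suc hi) (f ∘ pred)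
  chainOn-∘pred chain (suc i) (s≤s lo≤i) (s≤s i<hi) = chain i lo≤i i<hi

  chainOn-splice : ∀ {lo s hi f g} → ChainOn lo s f → (s < hi → f s ⊏ g (suc s))
                 → ChainOn (suc s) hi g → ChainOn lo hi (splice s f g)
  chainOn-splice {s = s} {f = f} {g} chain-f junction chain-g i lo≤i i<hi with <-cmp i s
  ... | tri< i<s _ _ = subst₂ _⊏_ (sym (splice-≤ (<⇒≤ i<s))) (sym (splice-≤ i<s)) (chain-f i lo≤i i<s)
  ... | tri≈ _ refl _ = subst₂ _⊏_ (sym (splice-≤ {f = f} {g} ≤-refl)) (sym (splice-> {f = f} {g} ≤-refl)) (junction i<hi)
  ... | tri> _ _ s<i = subst₂ _⊏_ (sym (splice-> s<i)) (sym (splice-> (m<n⇒m<1+n s<i))) (chain-g i s<i i<hi)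

  chainOn⇒⊏ : Transitive _⊏_ → ∀ {lo hi f i j} → ChainOn lo hi f → lo ≤ i → i < j → j ≤ hi → f i ⊏ f j
  chainOn⇒⊏ ⊏-trans {j = suc j} chain lo≤i (s≤s i≤j) j<hi with m≤n⇒m<n∨m≡n i≤j
  ... | inj₁ i<j  = ⊏-trans (chainOn⇒⊏ ⊏-trans chain lo≤i i<j (<⇒≤ j<hi)) (chain j (≤-trans lo≤i (<⇒≤ i<j)) j<hi)
  ... | inj₂ refl = chain j lo≤i j<hi

module Precedence {o ℓ₁ ℓ₂} (O : StrictTotalOrder o ℓ₁ ℓ₂) {n : ℕ}
                  (a : Fin n → StrictTotalOrder.Carrier O) where
  open StrictTotalOrder O renaming (_<_ to _≺_; trans to ≺-trans; irrefl to ≺-irrefl)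

  _⊏_ : Rel (Fin n) ℓ₂
  u ⊏ v = toℕ u < toℕ v × a u ≺ a v

  ⊏-trans : Transitive _⊏_
  ⊏-trans (u<v , au≺av) (v<w , av≺aw) = <-trans u<v v<w , ≺-trans au≺av av≺aw

  value≺∧¬⊏⇒position< : ∀ {u v} → a v ≺ a u → ¬ v ⊏ u → toℕ u < toℕ v
  value≺∧¬⊏⇒position< {u} {v} av≺au ¬v⊏u with <-cmp (toℕ u) (toℕ v)
  ... | tri< u<v _ _  = u<v
  ... | tri≈ _ u≡v _ = ⊥-elim (≺-irrefl Eq.refl (subst (λ w → a w ≺ a u) (toℕ-injective (sym u≡v)) av≺au))
  ... | tri> _ _ v<u  = ⊥-elim (¬v⊏u (v<u , av≺au))

  module Distinct (a-injective : ∀ u v → a u ≈ a v → u ≡ v) where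

    values-≺-or-≻ : ∀ {u v} → toℕ u < toℕ v → a u ≺ a v ⊎ a v ≺ a u
    values-≺-or-≻ {u} {v} u<v with compare (a u) (a v)
    ... | tri< au≺av _ _ = inj₁ au≺av
    ... | tri≈ _ au≈av _ = ⊥-elim (<-irrefl (cong toℕ (a-injective u v au≈av)) u<v)
    ... | tri> _ _ av≺au = inj₂ av≺au

    position<∧¬⊏⇒value≻ : ∀ {u v} → toℕ u < toℕ v → ¬ u ⊏ v → a v ≺ a u
    position<∧¬⊏⇒value≻ u<v ¬u⊏v with values-≺-or-≻ u<v
    ... | inj₁ au≺av = ⊥-elim (¬u⊏v (u<v , au≺av))
    ... | inj₂ av≺au = av≺au

module Subsequences {o ℓ₁ ℓ₂} (O : StrictTotalOrder o ℓ₁ ℓ₂) {n : ℕ}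
                    (a : Fin n → StrictTotalOrder.Carrier O) (k₁ : ℕ) where
  open Greedy O n a (suc k₁)
  open Precedence O a
  open Chains _⊏_

  extend : (Fin (suc k₁) → Fin n) → ℕ → Fin n
  extend X i with i <? suc k₁
  ... | yes i<k = X (fromℕ< i<k)
  ... | no  _   = X Fin.zero

  extend-< : ∀ X {i} (i<k : i < suc k₁) → extend X i ≡ X (fromℕ< i<k)
  extend-< X {i} i<k with i <? suc k₁
  ... | yes _   = refl
  ... | no  i≮k = contradiction i<k i≮k

  extend-toℕ : ∀ X f → extend X (toℕ f) ≡ X f
  extend-toℕ X f = trans (extend-< X (toℕ<n f)) (cong X (fromℕ<-toℕ f (toℕ<n f)))

  incSubseq⇒chainOn : ∀ {q j X} → IsIncSubseq q j X → ChainOn 0 k₁ (extend X)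
  incSubseq⇒chainOn {X = X} (increasing , _) i _ i<k₁ =
    subst₂ _⊏_ (sym (extend-< X i<k)) (sym (extend-< X (s≤s i<k₁)))
      (increasing _ _ (subst₂ _<_ (sym (toℕ-fromℕ< i<k)) (sym (toℕ-fromℕ< (s≤s i<k₁))) (n<1+n i)))
    where
    i<k : i < suc k₁
    i<k = m<n⇒m<1+n i<k₁

  incSubseq⇒bounds : ∀ {q j X} → IsIncSubseq q j X → ∀ i → i ≤ k₁
                   → q ≤ toℕ (extend X i) × toℕ (extend X i) ≤ j
  incSubseq⇒bounds {X = X} (_ , bounds) i i≤k₁ rewrite extend-< X (s≤s i≤k₁) = bounds _

  chainOn⇒incSubseq : ∀ {q j g} → ChainOn 0 k₁ g → q ≤ toℕ (g 0) → toℕ (g k₁) ≤ j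
                    → IsIncSubseq q j (g ∘ toℕ)
  chainOn⇒incSubseq {g = g} chain q≤first last≤j =
    (λ s t s<t → chainOn⇒⊏ ⊏-trans chain z≤n s<t (s≤s⁻¹ (toℕ<n t))) ,
    (λ t → ≤-trans q≤first (position-mono z≤n (s≤s⁻¹ (toℕ<n t)))
         , ≤-trans (position-mono (s≤s⁻¹ (toℕ<n t)) ≤-refl) last≤j)
    where
    position-mono : ∀ {i i′} → i ≤ i′ → i′ ≤ k₁ → toℕ (g i) ≤ toℕ (g i′)
    position-mono i≤i′ i′≤k₁ with m≤n⇒m<n∨m≡n i≤i′
    ... | inj₁ i<i′ = <⇒≤ (proj₁ (chainOn⇒⊏ ⊏-trans chain z≤n i<i′ i′≤k₁))
    ... | inj₂ refl = ≤-refl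

  extend≡ : ∀ {X g w} (w<k : w < suc k₁) → X (fromℕ< w<k) ≡ g (toℕ (fromℕ< w<k)) → extend X w ≡ g w
  extend≡ {X} {g} w<k e = trans (extend-< X w<k) (trans e (cong g (toℕ-fromℕ< w<k)))

  ¬≤lex-at : ∀ {X g w} → w ≤ k₁ → (∀ i → i < w → extend X i ≡ g i)
           → toℕ (g w) < toℕ (extend X w) → ¬ X ≤lex (g ∘ toℕ)
  ¬≤lex-at {g = g} w≤k₁ agree g<X (inj₁ X≗g) = <-irrefl (cong toℕ (sym (extend≡ {g = g} (s≤s w≤k₁) (X≗g _)))) g<X
  ¬≤lex-at {X} {g} {w} w≤k₁ agree g<X (inj₂ (u , agree-before-u , Xu<gu)) with <-cmp (toℕ u) w
  ... | tri< u<w _ _ = <-irrefl (cong toℕ (trans (sym (extend-toℕ X u)) (agree (toℕ u) u<w))) Xu<gu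
  ... | tri≈ _ refl _ = <-asym Xu<gu (subst (λ v → toℕ (g (toℕ u)) < toℕ v) (extend-toℕ X u) g<X)
  ... | tri> _ _ w<u = <-irrefl (cong toℕ (sym (extend≡ {g = g} (s≤s w≤k₁) (agree-before-u _ W<u)))) g<X
    where
    W<u : toℕ (fromℕ< (s≤s w≤k₁)) < toℕ u
    W<u = subst (_< toℕ u) (sym (toℕ-fromℕ< (s≤s w≤k₁))) w<u

  hasIncSubseq⇒≤ : ∀ {q j} → HasIncSubseq q j → q ≤ j
  hasIncSubseq⇒≤ (_ , _ , bounds) = ≤-trans (proj₁ (bounds Fin.zero)) (proj₂ (bounds Fin.zero))

  step-maximal : ∀ {i q j} → Step i q j → ∀ q′ → q < q′ → ¬ HasIncSubseq q′ j
  step-maximal (_ , _ , _ , _ , _ , _ , maximal) q′ q<q′ has = maximal q′ q<q′ (hasIncSubseq⇒≤ has) has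

  step-minimal : ∀ {i q j} → Step i q j → ∀ j′ → j′ < j → ¬ HasIncSubseq i j′
  step-minimal (_ , _ , _ , minimal , _) j′ j′<j has = minimal j′ (hasIncSubseq⇒≤ has) j′<j has

  step-start≤ : ∀ {i q j} → Step i q j → i ≤ q
  step-start≤ st@(_ , _ , has , _) = ≮⇒≥ (λ q<i → step-maximal st _ q<i has)

module ConsecutiveSuffixes
  {o ℓ₁ ℓ₂} (O : StrictTotalOrder o ℓ₁ ℓ₂) {n : ℕ} (a : Fin n → StrictTotalOrder.Carrier O)
  (a-injective : ∀ u v → StrictTotalOrder._≈_ O (a u) (a v) → u ≡ v)
  (k₂ : ℕ) {b c q j : ℕ} {X Y : Fin (suc (suc k₂)) → Fin n}
  (X-lexMin : Greedy.IsLexMinIncSubseq O n a (suc (suc k₂)) b c X)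
  (b-maximal : ∀ q′ → b < q′ → ¬ Greedy.HasIncSubseq O n a (suc (suc k₂)) q′ c)
  (Y-inc : Greedy.IsIncSubseq O n a (suc (suc k₂)) q j Y)
  (b<q : b < q)
  (j-minimal : ∀ j′ → j′ < j → ¬ Greedy.HasIncSubseq O n a (suc (suc k₂)) (suc b) j′)
  where
  open StrictTotalOrder O renaming (_<_ to _≺_; trans to ≺-trans) using ()
  open Precedence O a
  open Distinct a-injective
  open Chains _⊏_
  open Subsequences O a (suc k₂)

  x y : ℕ → Fin n
  x = extend X
  y = extend Y

  x-chain : ChainOn 0 (suc k₂) x
  x-chain = incSubseq⇒chainOn (proj₁ X-lexMin)

  y-chain : ChainOn 0 (suc k₂) y
  y-chain = incSubseq⇒chainOn Y-inc

  b≤x₀ : b ≤ toℕ (x 0)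
  b≤x₀ = proj₁ (incSubseq⇒bounds (proj₁ X-lexMin) 0 z≤n)

  x-last≤c : toℕ (x (suc k₂)) ≤ c
  x-last≤c = proj₂ (incSubseq⇒bounds (proj₁ X-lexMin) (suc k₂) ≤-refl)

  q≤y₀ : q ≤ toℕ (y 0)
  q≤y₀ = proj₁ (incSubseq⇒bounds Y-inc 0 z≤n)

  y-last≤j : toℕ (y (suc k₂)) ≤ j
  y-last≤j = proj₂ (incSubseq⇒bounds Y-inc (suc k₂) ≤-refl)

  -- Otherwise y₀ … y_s x_{s+1} … x_{k-1} is increasing in (a_{b+1}, …, a_c).
  ¬y⊏x-suc : ∀ s → s ≤ k₂ → ¬ y s ⊏ x (suc s)
  ¬y⊏x-suc s s≤k₂ ys⊏xs+1 = b-maximal (suc b) ≤-refl (_ , chainOn⇒incSubseq chain first last)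
    where
    chain : ChainOn 0 (suc k₂) (splice s y x)
    chain = chainOn-splice (chainOn-mono ≤-refl (m≤n⇒m≤1+n s≤k₂) y-chain) (λ _ → ys⊏xs+1)
                           (chainOn-mono z≤n ≤-refl x-chain)
    first : suc b ≤ toℕ (splice s y x 0)
    first rewrite splice-≤ {f = y} {x} (z≤n {s}) = ≤-trans b<q q≤y₀
    last : toℕ (splice s y x (suc k₂)) ≤ c
    last rewrite splice-> {f = y} {x} (s≤s s≤k₂) = x-last≤c

  -- Otherwise x₁ … x_{s+1} y_s … y_{k-2} is increasing in (a_{b+1}, …, a_{y_{k-2}}).
  ¬x-suc⊏y : ∀ s → s ≤ k₂ → ¬ x (suc s) ⊏ y s
  ¬x-suc⊏y s s≤k₂ xs+1⊏ys =
    j-minimal (toℕ (y k₂)) (<-≤-trans (proj₁ (y-chain k₂ z≤n ≤-refl)) y-last≤j)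
              (_ , chainOn⇒incSubseq chain first last)
    where
    chain : ChainOn 0 (suc k₂) (splice s (x ∘ suc) (y ∘ pred))
    chain = chainOn-splice (chainOn-∘suc (chainOn-mono z≤n (s≤s s≤k₂) x-chain))
                           (λ _ → xs+1⊏ys)
                           (chainOn-mono (s≤s z≤n) (n≤1+n _) (chainOn-∘pred y-chain))
    first : suc b ≤ toℕ (splice s (x ∘ suc) (y ∘ pred) 0)
    first rewrite splice-≤ {f = x ∘ suc} {y ∘ pred} (z≤n {s}) =
      ≤-<-trans b≤x₀ (proj₁ (x-chain 0 z≤n (s≤s z≤n)))
    last : toℕ (splice s (x ∘ suc) (y ∘ pred) (suc k₂)) ≤ toℕ (y k₂)
    last rewrite splice-> {f = x ∘ suc} {y ∘ pred} (s≤s s≤k₂) = ≤-refl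

  -- Otherwise x₀ … x_t y_t … y_m x_{m+2} … x_{k-1} is increasing in (a_b, …, a_c) and
  -- lexicographically smaller than X.
  ¬detour : ∀ {t m} → t ≤ m → m ≤ k₂ → x t ⊏ y t → toℕ (y t) < toℕ (x (suc t))
          → toℕ (y m) < toℕ (x (suc m)) → (m < k₂ → a (y m) ≺ a (x (suc (suc m)))) → ⊥
  ¬detour {t} {m} t≤m m≤k₂ xt⊏yt yt<xt+1 ym<xm+1 ym≺xm+2 =
    ¬≤lex-at (s≤s t≤k₂) agree differ (proj₂ X-lexMin _ (chainOn⇒incSubseq chain first last))
    where
    t≤k₂ : t ≤ k₂
    t≤k₂ = ≤-trans t≤m m≤k₂
    detour : ℕ → Fin n
    detour = splice (suc m) (y ∘ pred) x
    Z : ℕ → Fin n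
    Z = splice t x detour
    Z-at-t+1 : Z (suc t) ≡ y t
    Z-at-t+1 = trans (splice-> {f = x} {detour} (≤-refl {suc t})) (splice-≤ {f = y ∘ pred} {x} (s≤s t≤m))
    detour-chain : ChainOn (suc t) (suc k₂) detour
    detour-chain = chainOn-splice (chainOn-mono (s≤s z≤n) (s≤s (m≤n⇒m≤1+n m≤k₂)) (chainOn-∘pred y-chain))
                     (λ m+1<1+k₂ → <-trans ym<xm+1 (proj₁ (x-chain (suc m) z≤n m+1<1+k₂))
                               , ym≺xm+2 (s≤s⁻¹ m+1<1+k₂))
                     (chainOn-mono z≤n ≤-refl x-chain)
    chain : ChainOn 0 (suc k₂) Z
    chain = chainOn-splice (chainOn-mono ≤-refl (m≤n⇒m≤1+n t≤k₂) x-chain)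
                           (λ _ → subst (x t ⊏_) (sym (splice-≤ {f = y ∘ pred} {x} (s≤s t≤m))) xt⊏yt)
                           detour-chain
    first : b ≤ toℕ (Z 0)
    first rewrite splice-≤ {f = x} {detour} (z≤n {t}) = b≤x₀
    detour-last : toℕ (detour (suc k₂)) ≤ c
    detour-last with m≤n⇒m<n∨m≡n m≤k₂
    ... | inj₁ m<k₂ rewrite splice-> {f = y ∘ pred} {x} (s≤s m<k₂) = x-last≤c
    ... | inj₂ refl rewrite splice-≤ {f = y ∘ pred} {x} (≤-refl {suc m}) = <⇒≤ (<-≤-trans ym<xm+1 x-last≤c)
    last : toℕ (Z (suc k₂)) ≤ c
    last rewrite splice-> {f = x} {detour} (s≤s t≤k₂) = detour-last
    agree : ∀ i → i < suc t → x i ≡ Z i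
    agree i i<t+1 = sym (splice-≤ {f = x} {detour} (s≤s⁻¹ i<t+1))
    differ : toℕ (Z (suc t)) < toℕ (x (suc t))
    differ = subst (λ v → toℕ v < toℕ (x (suc t))) (sym Z-at-t+1) yt<xt+1

  -- Each crossing y_m < x_{m+1} (in position) either closes a detour or forces the next one.
  ¬crossings : ∀ {t} → x t ⊏ y t → toℕ (y t) < toℕ (x (suc t))
             → ∀ m → m ≤ k₂ → t ≤ m → toℕ (y m) < toℕ (x (suc m)) → ⊥
  ¬crossings {t} xt⊏yt yt<xt+1 = downwardInduction P k₂ at-k₂ step
    where
    P : ℕ → Set
    P m = t ≤ m → toℕ (y m) < toℕ (x (suc m)) → ⊥
    at-k₂ : P k₂
    at-k₂ t≤k₂ yk₂<xk₁ = ¬detour t≤k₂ ≤-refl xt⊏yt yt<xt+1 yk₂<xk₁ (λ k₂<k₂ → contradiction k₂<k₂ (<-irrefl refl))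
    step : ∀ m → m < k₂ → P (suc m) → P m
    step m m<k₂ next t≤m ym<xm+1
      with values-≺-or-≻ (<-trans ym<xm+1 (proj₁ (x-chain (suc m) z≤n (s≤s m<k₂))))
    ... | inj₁ ym≺xm+2 = ¬detour t≤m (<⇒≤ m<k₂) xt⊏yt yt<xt+1 ym<xm+1 (λ _ → ym≺xm+2)
    ... | inj₂ xm+2≺ym =
      next (m≤n⇒m≤1+n t≤m)
           (value≺∧¬⊏⇒position< (≺-trans xm+2≺ym (proj₂ (y-chain m z≤n (m<n⇒m<1+n m<k₂))))
                                (¬x-suc⊏y (suc m) m<k₂))

  x₀<y₀ : toℕ (x 0) < toℕ (y 0)
  x₀<y₀ = ≤-<-trans x₀≤b (<-≤-trans b<q q≤y₀)
    where
    x₀≤b : toℕ (x 0) ≤ b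
    x₀≤b = ≮⇒≥ (λ b<x₀ → b-maximal _ b<x₀ (_ , chainOn⇒incSubseq x-chain ≤-refl x-last≤c))

  x-suc≤y-from : ∀ t → t ≤ k₂ → toℕ (x t) < toℕ (y t) → toℕ (x (suc t)) ≤ toℕ (y t)
  x-suc≤y-from t t≤k₂ xt<yt = ≮⇒≥ λ yt<xt+1 →
    let xt+1≺yt = position<∧¬⊏⇒value≻ yt<xt+1 (¬y⊏x-suc t t≤k₂)
    in ¬crossings (xt<yt , ≺-trans (proj₂ (x-chain t z≤n (s≤s t≤k₂))) xt+1≺yt) yt<xt+1
                  t t≤k₂ ≤-refl yt<xt+1

  x-suc≤y : ∀ t → t ≤ k₂ → toℕ (x (suc t)) ≤ toℕ (y t)
  x-suc≤y zero    _      = x-suc≤y-from 0 z≤n x₀<y₀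
  x-suc≤y (suc t) t<k₂ = x-suc≤y-from (suc t) t<k₂
    (≤-<-trans (x-suc≤y t (<⇒≤ t<k₂)) (proj₁ (y-chain t z≤n (s≤s (<⇒≤ t<k₂)))))

lemma6 : {c ℓ₁ ℓ₂ : Level} (O : StrictTotalOrder c ℓ₁ ℓ₂)
    (n : ℕ) (a : Fin n → StrictTotalOrder.Carrier O)
    → (∀ u v → StrictTotalOrder._≈_ O (a u) (a v) → u ≡ v)
    → (k : ℕ) → 1 < k
    → (i b c' q' j' : ℕ)
    → Greedy.Reached O n a k i
    → Greedy.Step O n a k i b c'
    → Greedy.Step O n a k (suc b) q' j'
    → (X X' : Fin k → Fin n)
    → Greedy.IsLexMinIncSubseq O n a k b c' X
    → Greedy.IsLexMinIncSubseq O n a k q' j' X'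
    → ∀ (t u : Fin k) → toℕ u ≡ suc (toℕ t) → toℕ (X u) ≤ toℕ (X' t)
lemma6 _ _ _ _ zero () _ _ _ _ _ _ _ _ _ _ _ _ _ _
lemma6 _ _ _ _ (suc zero) (s≤s ()) _ _ _ _ _ _ _ _ _ _ _ _ _ _
lemma6 O n a a-injective (suc (suc k₂)) _ _ _ _ _ _ _ step step′ X X' X-lexMin X'-lexMin t u u≡t+1 =
  begin
    toℕ (X u)                        ≡⟨ cong toℕ (sym (extend-toℕ X u)) ⟩
    toℕ (extend X (toℕ u))           ≡⟨ cong (toℕ ∘ extend X) u≡t+1 ⟩
    toℕ (extend X (suc (toℕ t)))     ≤⟨ x-suc≤y (toℕ t) (s≤s⁻¹ (s≤s⁻¹ (subst (_< suc (suc k₂)) u≡t+1 (toℕ<n u)))) ⟩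
    toℕ (extend X' (toℕ t))          ≡⟨ cong toℕ (extend-toℕ X' t) ⟩
    toℕ (X' t)                       ∎
  where
  open ≤-Reasoning
  open Subsequences O a (suc k₂)
  open ConsecutiveSuffixes O a a-injective k₂ X-lexMin (step-maximal step) (proj₁ X'-lexMin)
                           (step-start≤ step′) (step-minimal step′)
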